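{- Let $k$ be a positive integer and $m\ge 0$ an integer with $k\geq 5m$. Then $va_3^{\equiv}(K_{4k,4k,4k})\leq 3k-3m$.
   Context: All graphs are finite and simple. A $t$-coloring of a graph $G$ is a map $f:V(G)\to\{1,\dots,t\}$, with color classes $V_i=\{v: f(v)=i\}$. It is equitable if $\big||V_i|-|V_j|\big|\le 1$ for all $i,j$. A $(t,k)$-tree-coloring of $G$ is a $t$-coloring such that every connected component of each induced subgraph $G[V_i]$ is a tree of maximum degree at most $k$; an equitable $(t,k)$-tree-coloring is a $(t,k)$-tree-coloring that is equitable. The strong equitable vertex $k$-arboricity $va_k^{\equiv}(G)$ is the smallest integer $t$ such that $G$ has an equitable $(t',k)$-tree-coloring for every integer $t'\ge t$. $K_{n,n,n}$ denotes the complete tripartite graph whose three partite sets each have exactly $n$ vertices. -}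

module Defs where

open import Data.Nat using (ℕ; zero; suc; _+_; _*_; _≤_)
open import Data.Bool using (Bool; true; false; not)
open import Data.Fin using (Fin; zero; suc; inject₁; fromℕ; quotient)
open import Data.Fin.Properties using (_≟_)
open import Data.List using (List; length; filter)
open import Data.List.Base using (allFin)
open import Data.Product using (Σ; _×_)
open import Relation.Nullary using (¬_; does)
open import Relation.Binary.PropositionalEquality using (_≡_)
open import Function.Definitions using (Injective)

record Graph (N : ℕ) : Set where
  field
    adj   : Fin N → Fin N → Bool
    sym   : ∀ u v → adj u v ≡ adj v u
    irref : ∀ v → adj v v ≡ false
open Graph public

countB : {N : ℕ} → (Fin N → Bool) → ℕ
countB {N} p = length (filter (λ v → p v Data.Bool.≟ true) (allFin N))

-- A t-colouring with colours Fin t (colour i stands for i+1).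
Coloring : ℕ → ℕ → Set
Coloring N t = Fin N → Fin t

classSize : {N t : ℕ} → Coloring N t → Fin t → ℕ
classSize f i = countB (λ v → does (f v ≟ i))

Equitable : {N t : ℕ} → Coloring N t → Set
Equitable {t = t} f = ∀ (i j : Fin t) → classSize f i ≤ suc (classSize f j)

monoAdj : {N t : ℕ} → Graph N → Coloring N t → Fin N → Fin N → Bool
monoAdj G f u v = adj G u v Data.Bool.∧ does (f u ≟ f v)

monoDegree : {N t : ℕ} → Graph N → Coloring N t → Fin N → ℕ
monoDegree G f v = countB (λ u → monoAdj G f v u)

Cycle : {N : ℕ} → (Fin N → Fin N → Bool) → Set
Cycle {N} a =
  Σ ℕ λ l → Σ (Fin (3 + l) → Fin N) λ c →
    Injective _≡_ _≡_ c
    × (∀ (i : Fin (2 + l)) → a (c (inject₁ i)) (c (suc i)) ≡ true)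
    × (a (c (fromℕ (2 + l))) (c zero) ≡ true)

-- (t,k)-tree-colouring: every component of every G[V_i] is a tree of
-- maximum degree ≤ k, i.e. each G[V_i] is acyclic (a forest) and every
-- vertex has at most k neighbours of its own colour.
TreeColoring : {N t : ℕ} → Graph N → ℕ → Coloring N t → Set
TreeColoring G k f = (¬ Cycle (monoAdj G f)) × (∀ v → monoDegree G f v ≤ k)

HasEqTreeColoring : {N : ℕ} → Graph N → (t k : ℕ) → Set
HasEqTreeColoring {N} G t k =
  Σ (Coloring N t) λ f → Equitable f × TreeColoring G k f

-- va_k^≡(G) ≤ s.  Since the set { t : G has an equitable (t',k)-tree-colouring
-- for all t' ≥ t } is upward closed, its least element is ≤ s iff s belongs
-- to it.
StrongEqVAAtMost : {N : ℕ} → Graph N → (k s : ℕ) → Set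
StrongEqVAAtMost G k s = ∀ t′ → s ≤ t′ → HasEqTreeColoring G t′ k

K3 : (n : ℕ) → Graph (3 * n)
K3 n = record
  { adj   = λ u v → not (does (quotient {3} n u ≟ quotient {3} n v))
  ; sym   = symm
  ; irref = irr
  }
  where
  open import Relation.Nullary using (yes; no)
  open import Relation.Binary.PropositionalEquality using (refl)
  open import Relation.Binary.PropositionalEquality as P using ()
  symm : ∀ u v → not (does (quotient {3} n u ≟ quotient {3} n v))
               ≡ not (does (quotient {3} n v ≟ quotient {3} n u))
  symm u v with quotient {3} n u ≟ quotient {3} n v | quotient {3} n v ≟ quotient {3} n u
  ... | yes _ | yes _ = refl
  ... | no _  | no _  = refl
  ... | yes p | no q  = Data.Empty.⊥-elim (q (P.sym p))
    where import Data.Empty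
  ... | no p  | yes q = Data.Empty.⊥-elim (p (P.sym q))
    where import Data.Empty
  irr : ∀ v → not (does (quotient {3} n v ≟ quotient {3} n v)) ≡ false
  irr v with quotient {3} n v ≟ quotient {3} n v
  ... | yes _ = refl
  ... | no q  = Data.Empty.⊥-elim (q refl)
    where import Data.Empty

-- Order the vertices of K_{L,L,L} (L = 4k) part by part and cut the sequence into consecutive
-- blocks, colouring the positions of a block of length l cyclically with q fresh colours. If
-- s·q ≤ l ≤ s·q + q, every colour of the block gets s or s + 1 vertices, so a common s for all
-- blocks makes the colouring equitable. A colour class inside one part is independent, and a class
-- of a block of at most four vertices straddling two parts, with at most one vertex on one side,
-- is a star K_{1,r} with r ≤ 3; either way it induces a forest of maximum degree at most 3.
-- For t = 3q + r colours (r < 3) the hypothesis k ≥ 5m gives L ≤ 5q, and each part receives q or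
-- q + 1 colours with the common class size ⌊L/(q+1)⌋. This fails only for L = 3q + 1 and
-- L = 3q + 2, where explicit layouts with class size 2 or 3 and one or two straddling stars work.

module Submission where

open import Data.Bool using (Bool; true; false; not; _∧_; if_then_else_)
open import Data.Bool.Properties using (¬-not)
open import Data.Empty using (⊥; ⊥-elim)
open import Data.Fin as Fin using (Fin; toℕ; fromℕ<; quotient; remQuot; combine)
open import Data.Fin.Patterns using (0F; 1F; 2F; 3F)
import Data.Fin.Properties as Finₚ
open import Data.List using (List; []; _∷_; length; filter; tabulate)
open import Data.List.Relation.Unary.All using (All; []; _∷_)
open import Data.Unit using (⊤)
open import Data.Nat
open import Data.Nat.Divisibility using (_∣_; divides; ∣⇒≤; ∣m+n∣m⇒∣n; m∣m*n; ∣-trans)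
open import Data.Nat.DivMod
open import Data.Nat.Properties
open import Data.Nat.Tactic.RingSolver using (solve-∀)
open import Data.Product using (∃; _×_; _,_; proj₁; proj₂; uncurry)
open import Data.Sum using (_⊎_; inj₁; inj₂)
import Data.Sum as Sum
open import Function using (_∘_; id)
open import Function.Bundles using (mk⇔)
open import Relation.Nullary using (Dec; ¬_; does; yes; no)
open import Relation.Nullary.Decidable using (dec-true; dec-false; does-⇔)
open import Relation.Binary.PropositionalEquality
open import Defs hiding (sym)

-- Counting on initial segments of ℕ

indicator : Bool → ℕ
indicator true  = 1
indicator false = 0

count : (ℕ → Bool) → ℕ → ℕ
count p zero    = 0
count p (suc n) = indicator (p 0) + count (p ∘ suc) n

count-+ : ∀ p m n → count p (m + n) ≡ count p m + count (p ∘ (m +_)) n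
count-+ p zero    n = refl
count-+ p (suc m) n = trans (cong (indicator (p 0) +_) (count-+ (p ∘ suc) m n)) (sym (+-assoc (indicator (p 0)) _ _))

count-cong : ∀ {p q} n → (∀ j → j < n → p j ≡ q j) → count p n ≡ count q n
count-cong zero    eq = refl
count-cong (suc n) eq = cong₂ _+_ (cong indicator (eq 0 z<s)) (count-cong n (λ j j<n → eq (suc j) (s<s j<n)))

count-none : ∀ {p} n → (∀ j → j < n → p j ≡ false) → count p n ≡ 0
count-none zero    none = refl
count-none (suc n) none rewrite none 0 z<s = count-none n (λ j j<n → none (suc j) (s<s j<n))

indicator≤1 : ∀ b → indicator b ≤ 1
indicator≤1 true  = ≤-refl
indicator≤1 false = z≤n

count≤ : ∀ p n → count p n ≤ n
count≤ p zero    = z≤n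
count≤ p (suc n) = +-mono-≤ (indicator≤1 (p 0)) (count≤ (p ∘ suc) n)

indicator-mono : ∀ {a b} → (a ≡ true → b ≡ true) → indicator a ≤ indicator b
indicator-mono {true}  a⇒b rewrite a⇒b refl = ≤-refl
indicator-mono {false} a⇒b = z≤n

count-mono : ∀ {p q} n → (∀ j → p j ≡ true → q j ≡ true) → count p n ≤ count q n
count-mono zero    p⇒q = z≤n
count-mono (suc n) p⇒q = +-mono-≤ (indicator-mono (p⇒q 0)) (count-mono n (p⇒q ∘ suc))

count-mono-< : ∀ {p q w} n → w < n → (∀ j → p j ≡ true → q j ≡ true) →
               p w ≡ false → q w ≡ true → count p n < count q n
count-mono-< {w = zero}  (suc n) _ p⇒q pw qw rewrite pw | qw = s≤s (count-mono n (p⇒q ∘ suc))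
count-mono-< {p} {q} {suc w} (suc n) (s<s w<n) p⇒q pw qw = begin-strict
  indicator (p 0) + count (p ∘ suc) n  <⟨ +-monoʳ-< (indicator (p 0)) (count-mono-< n w<n (p⇒q ∘ suc) pw qw) ⟩
  indicator (p 0) + count (q ∘ suc) n  ≤⟨ +-monoˡ-≤ _ (indicator-mono (p⇒q 0)) ⟩
  indicator (q 0) + count (q ∘ suc) n  ∎
  where open ≤-Reasoning

count-≡-≤1 : ∀ i n → count (λ j → does (j ≟ i)) n ≤ 1
count-≡-≤1 i       zero    = z≤n
count-≡-≤1 zero    (suc n) = ≤-reflexive (cong suc (count-none n (λ _ _ → refl)))
count-≡-≤1 (suc i) (suc n) = count-≡-≤1 i n

count-≡-1 : ∀ {i n} → i < n → count (λ j → does (j ≟ i)) n ≡ 1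
count-≡-1 {zero}  {suc n} _         = cong suc (count-none n (λ _ _ → refl))
count-≡-1 {suc i} {suc n} (s<s i<n) = count-≡-1 i<n

count-tabulate : ∀ {A : Set} N (f : Fin N → A) (P : A → Bool) (p : ℕ → Bool) →
                 (∀ i → P (f i) ≡ p (toℕ i)) →
                 length (filter (λ x → P x Data.Bool.≟ true) (tabulate f)) ≡ count p N
count-tabulate zero    f P p eq = refl
count-tabulate (suc N) f P p eq with P (f Fin.zero) | eq Fin.zero
... | true  | e rewrite sym e = cong suc (count-tabulate N (f ∘ Fin.suc) P (p ∘ suc) (eq ∘ Fin.suc))
... | false | e rewrite sym e = count-tabulate N (f ∘ Fin.suc) P (p ∘ suc) (eq ∘ Fin.suc)

countB≡count : ∀ {N} (P : Fin N → Bool) (p : ℕ → Bool) → (∀ v → P v ≡ p (toℕ v)) →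
               countB P ≡ count p N
countB≡count {N} P p = count-tabulate N id P p

-- Colour classes of positions and tree colourings of K_{n,n,n}

fromDoes : ∀ {a} {A : Set a} (a? : Dec A) → does a? ≡ true → A
fromDoes (yes a) _ = a

∧-true : ∀ {a b} → a ∧ b ≡ true → a ≡ true × b ≡ true
∧-true {true} {true} _ = refl , refl

not-true : ∀ {a} → not a ≡ true → a ≢ true
not-true {false} _ ()

[m*n+r]/n≡m : ∀ m {n r} .{{_ : NonZero n}} → r < n → (m * n + r) / n ≡ m
[m*n+r]/n≡m m {n} {r} r<n = begin
  (m * n + r) / n    ≡⟨ +-distrib-/-∣ˡ r (divides m refl) ⟩
  m * n / n + r / n  ≡⟨ cong₂ _+_ (m*n/n≡m m n) (m<n⇒m/n≡0 r<n) ⟩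
  m + 0              ≡⟨ +-identityʳ m ⟩
  m                  ∎
  where open ≡-Reasoning

toℕ-quotient : ∀ m n .{{_ : NonZero n}} (v : Fin (m * n)) → toℕ (quotient {m} n v) ≡ toℕ v / n
toℕ-quotient m n v = sym (begin
  toℕ v / n                     ≡⟨ cong (λ w → toℕ w / n) (sym (Finₚ.combine-remQuot {m} n v)) ⟩
  toℕ (combine q r) / n         ≡⟨ cong (_/ n) (Finₚ.toℕ-combine q r) ⟩
  (n * toℕ q + toℕ r) / n       ≡⟨ cong (λ x → (x + toℕ r) / n) (*-comm n (toℕ q)) ⟩
  (toℕ q * n + toℕ r) / n       ≡⟨ [m*n+r]/n≡m (toℕ q) (Finₚ.toℕ<n r) ⟩
  toℕ q                         ∎)
  where
  open ≡-Reasoning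
  q = proj₁ (remQuot {m} n v)
  r = proj₂ (remQuot {m} n v)

does-toℕ≟ : ∀ {m} (a b : Fin m) → does (a Finₚ.≟ b) ≡ does (toℕ a ≟ toℕ b)
does-toℕ≟ a b = does-⇔ (mk⇔ (cong toℕ) Finₚ.toℕ-injective) (a Finₚ.≟ b) (toℕ a ≟ toℕ b)

classCount : (ℕ → ℕ) → ℕ → ℕ → ℕ
classCount g n i = count (λ p → does (g p ≟ i)) n

Near : ℕ → ℕ → Set
Near s c = s ≤ c × c ≤ suc s

Member : (ℕ → ℕ) → ℕ → ℕ → ℕ → Set
Member g n i p = p < n × g p ≡ i

Monopartite : (part g : ℕ → ℕ) (n i : ℕ) → Set
Monopartite part g n i = ∀ {p p′} → Member g n i p → Member g n i p′ → part p ≡ part p′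

CentredAt : (part g : ℕ → ℕ) (n i z : ℕ) → Set
CentredAt part g n i z =
  ∀ {p p′} → Member g n i p → Member g n i p′ → part p ≢ part p′ → p ≡ z ⊎ p′ ≡ z

-- In a complete multipartite graph whose parts are the fibres of  part,  a star class
-- induces either no edge at all or a star K_{1,r} with r ≤ 3.
StarClass : (part g : ℕ → ℕ) (n i : ℕ) → Set
StarClass part g n i = Monopartite part g n i ⊎ (classCount g n i ≤ 4 × ∃ (CentredAt part g n i))

path-through-centre-revisits : ∀ {a b c d z : ℕ} → a ≡ z ⊎ b ≡ z → b ≡ z ⊎ c ≡ z → c ≡ z ⊎ d ≡ z →
                               a ≡ c ⊎ b ≡ c ⊎ b ≡ d
path-through-centre-revisits _           (inj₁ refl) (inj₁ refl) = inj₂ (inj₁ refl)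
path-through-centre-revisits _           (inj₁ refl) (inj₂ refl) = inj₂ (inj₂ refl)
path-through-centre-revisits (inj₁ refl) (inj₂ refl) _           = inj₁ refl
path-through-centre-revisits (inj₂ refl) (inj₂ refl) _           = inj₂ (inj₁ refl)

module _ (n : ℕ) .{{_ : NonZero n}} {t s : ℕ} (g : ℕ → ℕ)
         (g<t : ∀ p → p < 3 * n → g p < t)
         (balanced : ∀ i → i < t → Near s (classCount g (3 * n) i))
         (stars : ∀ i → i < t → StarClass (_/ n) g (3 * n) i) where

  private
    colouring : Coloring (3 * n) t
    colouring v = fromℕ< (g<t (toℕ v) (Finₚ.toℕ<n v))

    toℕ-colouring : ∀ v → toℕ (colouring v) ≡ g (toℕ v)
    toℕ-colouring v = Finₚ.toℕ-fromℕ< (g<t (toℕ v) (Finₚ.toℕ<n v))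

    starClassOf : ∀ v → StarClass (_/ n) g (3 * n) (g (toℕ v))
    starClassOf v = stars (g (toℕ v)) (g<t (toℕ v) (Finₚ.toℕ<n v))

    does-colouring≟ : ∀ u i → does (colouring u Finₚ.≟ i) ≡ does (g (toℕ u) ≟ toℕ i)
    does-colouring≟ u i = trans (does-toℕ≟ (colouring u) i) (cong (λ x → does (x ≟ toℕ i)) (toℕ-colouring u))

    equitable : Equitable colouring
    equitable i j = ≤-trans (proj₂ (bounds i)) (s≤s (proj₁ (bounds j)))
      where
      bounds : ∀ i → Near s (classSize colouring i)
      bounds i rewrite countB≡count _ (λ p → does (g p ≟ toℕ i)) (λ v → does-colouring≟ v i) =
        balanced (toℕ i) (Finₚ.toℕ<n i)

    crossing : ℕ → ℕ → Bool
    crossing p p′ = not (does (p / n ≟ p′ / n)) ∧ does (g p ≟ g p′)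

    crossing-true : ∀ {p p′} → crossing p p′ ≡ true → p / n ≢ p′ / n × g p ≡ g p′
    crossing-true {p} {p′} e with ∧-true e
    ... | apart , same = (λ eq → not-true apart (dec-true (p / n ≟ p′ / n) eq)) , fromDoes (g p ≟ g p′) same

    crossing-irrefl : ∀ p → crossing p p ≡ false
    crossing-irrefl p rewrite dec-true (p / n ≟ p / n) refl = refl

    monoAdj≡crossing : ∀ u v → monoAdj (K3 n) colouring u v ≡ crossing (toℕ u) (toℕ v)
    monoAdj≡crossing u v = cong₂ _∧_
      (cong not (trans (does-toℕ≟ (quotient {3} n u) (quotient {3} n v))
                       (cong₂ (λ x y → does (x ≟ y)) (toℕ-quotient 3 n u) (toℕ-quotient 3 n v))))
      (trans (does-toℕ≟ (colouring u) (colouring v))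
             (cong₂ (λ x y → does (x ≟ y)) (toℕ-colouring u) (toℕ-colouring v)))

    monoEdge : ∀ {u v} → monoAdj (K3 n) colouring u v ≡ true →
               toℕ u / n ≢ toℕ v / n × g (toℕ u) ≡ g (toℕ v)
    monoEdge {u} {v} e = crossing-true (trans (sym (monoAdj≡crossing u v)) e)

    degree≤3 : ∀ v → monoDegree (K3 n) colouring v ≤ 3
    degree≤3 v rewrite countB≡count _ (crossing (toℕ v)) (monoAdj≡crossing v) with starClassOf v
    ... | inj₁ monopartite = ≤-trans (≤-reflexive (count-none (3 * n) (λ p p< → ¬-not (noCrossing p p<)))) z≤n
      where
      noCrossing : ∀ p → p < 3 * n → crossing (toℕ v) p ≢ true
      noCrossing p p< e with crossing-true e
      ... | apart , same = apart (monopartite (Finₚ.toℕ<n v , refl) (p< , sym same))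
    ... | inj₂ (small , _) =
      s≤s⁻¹ (≤-trans (count-mono-< (3 * n) (Finₚ.toℕ<n v) sameClass (crossing-irrefl (toℕ v))
                                   (dec-true (g (toℕ v) ≟ g (toℕ v)) refl))
                     small)
      where
      sameClass : ∀ p → crossing (toℕ v) p ≡ true → does (g p ≟ g (toℕ v)) ≡ true
      sameClass p e = dec-true (g p ≟ g (toℕ v)) (sym (proj₂ (crossing-true e)))

    noMonoPath : (a b c d : Fin (3 * n)) →
                 monoAdj (K3 n) colouring a b ≡ true → monoAdj (K3 n) colouring b c ≡ true →
                 monoAdj (K3 n) colouring c d ≡ true →
                 toℕ a ≢ toℕ c → toℕ b ≢ toℕ c → toℕ b ≢ toℕ d → ⊥
    noMonoPath a b c d ab bc cd a≢c b≢c b≢d with monoEdge ab | monoEdge bc | monoEdge cd | starClassOf a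
    ... | a∦b , ga≡gb | _ | _ | inj₁ monopartite =
      a∦b (monopartite (Finₚ.toℕ<n a , refl) (Finₚ.toℕ<n b , sym ga≡gb))
    ... | a∦b , ga≡gb | b∦c , gb≡gc | c∦d , gc≡gd | inj₂ (_ , z , centred)
      with path-through-centre-revisits (centred ma mb a∦b) (centred mb mc b∦c) (centred mc md c∦d)
      where
      member : ∀ x → g (toℕ x) ≡ g (toℕ a) → Member g (3 * n) (g (toℕ a)) (toℕ x)
      member x same = Finₚ.toℕ<n x , same
      ma = member a refl
      mb = member b (sym ga≡gb)
      mc = member c (trans (sym gb≡gc) (sym ga≡gb))
      md = member d (trans (sym gc≡gd) (proj₂ mc))
    ... | inj₁ a≡c        = a≢c a≡c
    ... | inj₂ (inj₁ b≡c) = b≢c b≡c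
    ... | inj₂ (inj₂ b≡d) = b≢d b≡d

    distinct : ∀ {m} (c : Fin m → Fin (3 * n)) → (∀ {i j} → c i ≡ c j → i ≡ j) →
               ∀ i j → i ≢ j → toℕ (c i) ≢ toℕ (c j)
    distinct c injective i j i≢j = i≢j ∘ injective ∘ Finₚ.toℕ-injective

    acyclic : ¬ Cycle (monoAdj (K3 n) colouring)
    acyclic (zero , c , injective , edge , closing) =
      noMonoPath (c 0F) (c 1F) (c 2F) (c 0F) (edge 0F) (edge 1F) closing
        (distinct c injective 0F 2F λ ()) (distinct c injective 1F 2F λ ()) (distinct c injective 1F 0F λ ())
    acyclic (suc l , c , injective , edge , _) =
      noMonoPath (c 0F) (c 1F) (c 2F) (c 3F) (edge 0F) (edge 1F) (edge 2F)
        (distinct c injective 0F 2F λ ()) (distinct c injective 1F 2F λ ()) (distinct c injective 1F 3F λ ())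

  equitableTreeColouring-K3 : HasEqTreeColoring (K3 n) t 3
  equitableTreeColouring-K3 = colouring , equitable , acyclic , degree≤3

-- Cyclic blocks and their concatenation

<-or-offset : ∀ n p → p < n ⊎ ∃ λ j → p ≡ n + j
<-or-offset n p with p <? n
... | yes p<n = inj₁ p<n
... | no  p≮n = inj₂ (p ∸ n , sym (m+[n∸m]≡n (≮⇒≥ p≮n)))

Bounded : (ℕ → ℕ) → ℕ → ℕ → Set
Bounded g n t = ∀ p → p < n → g p < t

record Balanced (s l q : ℕ) : Set where
  constructor balanced
  field
    lower : s * q ≤ l
    upper : l ≤ s * q + q

-- The junk value at q = 0 is harmless: a balanced block without colours is empty.
cyclic : ℕ → ℕ → ℕ
cyclic zero    _ = 0
cyclic (suc q) p = p % suc q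

cyclic-bounded : ∀ {s l q} → Balanced s l q → Bounded (cyclic q) l q
cyclic-bounded {s} {l} {zero} (balanced _ l≤s*0+0) p p<l = ⊥-elim (<⇒≱ p<l l≤p)
  where
  l≤p : l ≤ p
  l≤p = ≤-trans l≤s*0+0 (≤-trans (≤-reflexive (trans (+-identityʳ (s * 0)) (*-zeroʳ s))) z≤n)
cyclic-bounded {q = suc q} _ p _ = m%n<n p (suc q)

classCount-cyclic-period : ∀ {q i} l → i < suc q →
                           classCount (cyclic (suc q)) (suc q + l) i ≡ suc (classCount (cyclic (suc q)) l i)
classCount-cyclic-period {q} {i} l i<q = begin
  classCount (cyclic (suc q)) (suc q + l) i
    ≡⟨ count-+ (λ p → does (p % suc q ≟ i)) (suc q) l ⟩
  count (λ p → does (p % suc q ≟ i)) (suc q) + count (λ j → does ((suc q + j) % suc q ≟ i)) l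
    ≡⟨ cong₂ _+_ (trans (count-cong (suc q) (λ p p<q → cong (λ x → does (x ≟ i)) (m<n⇒m%n≡m p<q)))
                        (count-≡-1 i<q))
                 (count-cong l (λ j _ → cong (λ x → does (x ≟ i))
                                             (trans (cong (_% suc q) (+-comm (suc q) j)) ([m+n]%n≡m%n j (suc q))))) ⟩
  suc (classCount (cyclic (suc q)) l i)
    ∎
  where open ≡-Reasoning

classCount-cyclic : ∀ {s l q i} → Balanced s l q → i < q → Near s (classCount (cyclic q) l i)
classCount-cyclic {zero} {l} {suc q} {i} (balanced _ l≤q) i<q =
  z≤n , ≤-trans (≤-reflexive (count-cong l short)) (count-≡-≤1 i l)
  where
  short : ∀ p → p < l → does (p % suc q ≟ i) ≡ does (p ≟ i)
  short p p<l = cong (λ x → does (x ≟ i)) (m<n⇒m%n≡m (<-≤-trans p<l l≤q))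
classCount-cyclic {suc s} {l} {suc q} {i} (balanced lo hi) i<q with m≤n⇒∃[o]m+o≡n (m+n≤o⇒m≤o (suc q) lo)
... | l′ , refl rewrite classCount-cyclic-period l′ i<q =
  Data.Product.map s≤s s≤s (classCount-cyclic (balanced lo′ hi′) i<q)
  where
  lo′ : s * suc q ≤ l′
  lo′ = +-cancelˡ-≤ (suc q) _ _ lo
  hi′ : l′ ≤ s * suc q + suc q
  hi′ = +-cancelˡ-≤ (suc q) _ _ (≤-trans hi (≤-reflexive (+-assoc (suc q) (s * suc q) (suc q))))

append : ℕ → ℕ → (ℕ → ℕ) → (ℕ → ℕ) → ℕ → ℕ
append n t g h p = if does (p <? n) then g p else t + h (p ∸ n)

module _ {n t : ℕ} {g h : ℕ → ℕ} where

  append-< : ∀ {p} → p < n → append n t g h p ≡ g p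
  append-< {p} p<n rewrite dec-true (p <? n) p<n = refl

  append-+ : ∀ j → append n t g h (n + j) ≡ t + h j
  append-+ j rewrite dec-false (n + j <? n) (m+n≮m n j) | m+n∸m≡n n j = refl

  append-bounded : ∀ {m u} → Bounded g n t → Bounded h m u → Bounded (append n t g h) (n + m) (t + u)
  append-bounded {m} {u} g<t h<u p p< with <-or-offset n p
  ... | inj₁ p<n         = subst (_< t + u) (sym (append-< p<n)) (<-≤-trans (g<t p p<n) (m≤m+n t u))
  ... | inj₂ (j , refl) = subst (_< t + u) (sym (append-+ j)) (+-monoʳ-< t (h<u j (+-cancelˡ-< n _ _ p<)))

  classCount-append-< : ∀ {m i} → i < t → classCount (append n t g h) (n + m) i ≡ classCount g n i
  classCount-append-< {m} {i} i<t = begin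
    classCount (append n t g h) (n + m) i
      ≡⟨ count-+ _ n m ⟩
    count (λ p → does (append n t g h p ≟ i)) n + count (λ j → does (append n t g h (n + j) ≟ i)) m
      ≡⟨ cong₂ _+_ (count-cong n λ p p<n → cong (λ x → does (x ≟ i)) (append-< p<n))
                   (count-none m λ j _ → trans (cong (λ x → does (x ≟ i)) (append-+ j))
                                               (dec-false (t + h j ≟ i) (colour≥t j))) ⟩
    classCount g n i + 0
      ≡⟨ +-identityʳ _ ⟩
    classCount g n i
      ∎
    where
    open ≡-Reasoning
    colour≥t : ∀ j → t + h j ≢ i
    colour≥t j e = <⇒≱ i<t (subst (t ≤_) e (m≤m+n t (h j)))

  classCount-append-+ : ∀ {m i} → Bounded g n t →
                        classCount (append n t g h) (n + m) (t + i) ≡ classCount h m i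
  classCount-append-+ {m} {i} g<t = begin
    classCount (append n t g h) (n + m) (t + i)
      ≡⟨ count-+ _ n m ⟩
    count (λ p → does (append n t g h p ≟ t + i)) n + count (λ j → does (append n t g h (n + j) ≟ t + i)) m
      ≡⟨ cong₂ _+_ (count-none n λ p p<n → trans (cong (λ x → does (x ≟ t + i)) (append-< p<n))
                                                 (dec-false (g p ≟ t + i) (colour<t p p<n)))
                   (count-cong m λ j _ → trans (cong (λ x → does (x ≟ t + i)) (append-+ j)) (does-shift j)) ⟩
    classCount h m i
      ∎
    where
    open ≡-Reasoning
    colour<t : ∀ p → p < n → g p ≢ t + i
    colour<t p p<n e = <⇒≱ (g<t p p<n) (subst (t ≤_) (sym e) (m≤m+n t i))
    does-shift : ∀ j → does (t + h j ≟ t + i) ≡ does (h j ≟ i)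
    does-shift j = does-⇔ (mk⇔ (+-cancelˡ-≡ t _ _) (cong (t +_))) (t + h j ≟ t + i) (h j ≟ i)

  member-append-< : ∀ {m i p} → i < t → Member (append n t g h) (n + m) i p → Member g n i p
  member-append-< {p = p} i<t (p< , colour) with <-or-offset n p
  ... | inj₁ p<n         = p<n , trans (sym (append-< p<n)) colour
  ... | inj₂ (j , refl) = ⊥-elim (<⇒≱ i<t (subst (t ≤_) (trans (sym (append-+ j)) colour) (m≤m+n t _)))

  member-append-+ : ∀ {m i p} → Bounded g n t → Member (append n t g h) (n + m) (t + i) p →
                    ∃ λ j → p ≡ n + j × Member h m i j
  member-append-+ {i = i} {p} g<t (p< , colour) with <-or-offset n p
  ... | inj₁ p<n         =
    ⊥-elim (<⇒≱ (g<t p p<n) (subst (t ≤_) (sym (trans (sym (append-< p<n)) colour)) (m≤m+n t i)))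
  ... | inj₂ (j , refl) = j , refl , +-cancelˡ-< n _ _ p< , +-cancelˡ-≡ t _ _ (trans (sym (append-+ j)) colour)

  starClass-append-< : ∀ {part m i} → i < t → StarClass part g n i → StarClass part (append n t g h) (n + m) i
  starClass-append-< i<t (inj₁ monopartite) =
    inj₁ λ mp mp′ → monopartite (member-append-< i<t mp) (member-append-< i<t mp′)
  starClass-append-< i<t (inj₂ (small , z , centred)) =
    inj₂ (subst (_≤ 4) (sym (classCount-append-< i<t)) small , z ,
          λ mp mp′ → centred (member-append-< i<t mp) (member-append-< i<t mp′))

  starClass-append-+ : ∀ {part m i} → Bounded g n t → StarClass (part ∘ (n +_)) h m i →
                       StarClass part (append n t g h) (n + m) (t + i)
  starClass-append-+ {part} {m} {i} g<t (inj₁ monopartite) = inj₁ same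
    where
    same : Monopartite part (append n t g h) (n + m) (t + i)
    same mp mp′ with member-append-+ g<t mp | member-append-+ g<t mp′
    ... | j , refl , mj | j′ , refl , mj′ = monopartite mj mj′
  starClass-append-+ {part} {m} {i} g<t (inj₂ (small , z , centred)) =
    inj₂ (subst (_≤ 4) (sym (classCount-append-+ g<t)) small , n + z , centred′)
    where
    centred′ : CentredAt part (append n t g h) (n + m) (t + i) (n + z)
    centred′ mp mp′ apart with member-append-+ g<t mp | member-append-+ g<t mp′
    ... | j , refl , mj | j′ , refl , mj′ = Sum.map (cong (n +_)) (cong (n +_)) (centred mj mj′ apart)

StarSegment : (ℕ → ℕ) → ℕ → Set
StarSegment part l =
  (∀ {j j′} → j < l → j′ < l → part j ≡ part j′)
  ⊎ (l ≤ 4 × ∃ λ z → ∀ {j j′} → j < l → j′ < l → part j ≢ part j′ → j ≡ z ⊎ j′ ≡ z)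

starSegment⇒starClass : ∀ {part l} → StarSegment part l → ∀ g i → StarClass part g l i
starSegment⇒starClass {l = l} (inj₁ same) g i = inj₁ λ (j< , _) (j′< , _) → same j< j′<
starSegment⇒starClass {l = l} (inj₂ (l≤4 , z , centred)) g i =
  inj₂ (≤-trans (count≤ _ l) l≤4 , z , λ (j< , _) (j′< , _) → centred j< j′<)

Block : Set
Block = ℕ × ℕ

layout : List Block → ℕ → ℕ
layout []             = λ _ → 0
layout ((l , q) ∷ bs) = append l q (cyclic q) (layout bs)

span : List Block → ℕ
span []             = 0
span ((l , _) ∷ bs) = l + span bs

colours : List Block → ℕ
colours []             = 0
colours ((_ , q) ∷ bs) = q + colours bs

StarBlocks : (ℕ → ℕ) → List Block → Set
StarBlocks part []             = ⊤
StarBlocks part ((l , _) ∷ bs) = StarSegment part l × StarBlocks (part ∘ (l +_)) bs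

module _ {s : ℕ} where

  layout-bounded : ∀ {bs} → All (uncurry (Balanced s)) bs → Bounded (layout bs) (span bs) (colours bs)
  layout-bounded []                  p ()
  layout-bounded {(l , q) ∷ bs} (b ∷ bal) = append-bounded (cyclic-bounded b) (layout-bounded bal)

  classCount-layout : ∀ {bs} → All (uncurry (Balanced s)) bs → ∀ i → i < colours bs →
                      Near s (classCount (layout bs) (span bs) i)
  classCount-layout {(l , q) ∷ bs} (b ∷ bal) i i< with <-or-offset q i
  ... | inj₁ i<q =
    subst (Near s) (sym (classCount-append-< {l} {h = layout bs} i<q))
          (classCount-cyclic b i<q)
  ... | inj₂ (i′ , refl) =
    subst (Near s) (sym (classCount-append-+ {h = layout bs} (cyclic-bounded b)))
          (classCount-layout bal i′ (+-cancelˡ-< q _ _ i<))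

  starClass-layout : ∀ {part bs} → All (uncurry (Balanced s)) bs → StarBlocks part bs →
                     ∀ i → i < colours bs → StarClass part (layout bs) (span bs) i
  starClass-layout {part} {(l , q) ∷ bs} (b ∷ bal) (segment , segments) i i< with <-or-offset q i
  ... | inj₁ i<q         = starClass-append-< {h = layout bs} i<q (starSegment⇒starClass segment (cyclic q) i)
  ... | inj₂ (i′ , refl) =
    starClass-append-+ (cyclic-bounded b) (starClass-layout bal segments i′ (+-cancelˡ-< q _ _ i<))

layout⇒equitableTreeColouring : ∀ n .{{_ : NonZero n}} s bs → All (uncurry (Balanced s)) bs →
                                StarBlocks (_/ n) bs → span bs ≡ 3 * n → HasEqTreeColoring (K3 n) (colours bs) 3
layout⇒equitableTreeColouring n s bs bal stars span≡ = equitableTreeColouring-K3 n (layout bs)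
  (subst (λ N → Bounded (layout bs) N (colours bs)) span≡ (layout-bounded bal))
  (subst (λ N → ∀ i → i < colours bs → Near s (classCount (layout bs) N i)) span≡ (classCount-layout bal))
  (subst (λ N → ∀ i → i < colours bs → StarClass (_/ n) (layout bs) N i) span≡ (starClass-layout bal stars))

-- Layouts of K_{L,L,L} with straddling stars

Thin : ℕ → ℕ → Set
Thin a b = a + b ≤ 4 × (a ≤ 1 ⊎ b ≤ 1)

monopartite-segment : ∀ {part l} c → (∀ j → j < l → part j ≡ c) → StarSegment part l
monopartite-segment c inPart = inj₁ λ j< j′< → trans (inPart _ j<) (sym (inPart _ j′<))

straddle-segment : ∀ {part a b c c′} →
                   (∀ j → j < a → part j ≡ c) → (∀ k → k < b → part (a + k) ≡ c′) →
                   Thin a b → StarSegment part (a + b)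
straddle-segment {part} {a} {b} left right (a+b≤4 , thin) = inj₂ (a+b≤4 , centre thin , through)
  where
  centre : a ≤ 1 ⊎ b ≤ 1 → ℕ
  centre (inj₁ _) = 0
  centre (inj₂ _) = a

  thinSide-centre : ∀ th {j k} → j < a → k < b → j ≡ centre th ⊎ a + k ≡ centre th
  thinSide-centre (inj₁ a≤1) j<a _   = inj₁ (n<1⇒n≡0 (<-≤-trans j<a a≤1))
  thinSide-centre (inj₂ b≤1) _   k<b =
    inj₂ (trans (cong (a +_) (n<1⇒n≡0 (<-≤-trans k<b b≤1))) (+-identityʳ a))

  through : ∀ {j j′} → j < a + b → j′ < a + b → part j ≢ part j′ →
            j ≡ centre thin ⊎ j′ ≡ centre thin
  through {j} {j′} j< j′< apart with <-or-offset a j | <-or-offset a j′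
  ... | inj₁ j<a         | inj₁ j′<a          = ⊥-elim (apart (trans (left j j<a) (sym (left j′ j′<a))))
  ... | inj₁ j<a         | inj₂ (k′ , refl) = thinSide-centre thin j<a (+-cancelˡ-< a _ _ j′<)
  ... | inj₂ (k , refl) | inj₁ j′<a          = Sum.swap (thinSide-centre thin j′<a (+-cancelˡ-< a _ _ j<))
  ... | inj₂ (k , refl) | inj₂ (k′ , refl) =
    ⊥-elim (apart (trans (right k (+-cancelˡ-< a _ _ j<)) (sym (right k′ (+-cancelˡ-< a _ _ j′<)))))

/-≡ : ∀ {L} .{{_ : NonZero L}} c {x r} → x ≡ c * L + r → r < L → x / L ≡ c
/-≡ c refl r<L = [m*n+r]/n≡m c r<L

-- The blocks are A, S₁, B, S₂, C in this order: part 0 is A followed by the first a₁ positions of S₁,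
-- part 1 the last b₁ positions of S₁, B and the first a₂ positions of S₂, part 2 the rest.
record ThreePartLayout (L t : ℕ) : Set where
  field
    s lenA a₁ b₁ lenB a₂ b₂ lenC colA col₁ colB col₂ colC : ℕ
    part₀      : lenA + a₁ ≡ L
    part₁      : b₁ + lenB + a₂ ≡ L
    part₂      : b₂ + lenC ≡ L
    balancedA  : Balanced s lenA colA
    balanced₁  : Balanced s (a₁ + b₁) col₁
    balancedB  : Balanced s lenB colB
    balanced₂  : Balanced s (a₂ + b₂) col₂
    balancedC  : Balanced s lenC colC
    thin₁      : Thin a₁ b₁
    thin₂      : Thin a₂ b₂
    total      : colA + col₁ + colB + col₂ + colC ≡ t

module _ {L t : ℕ} .{{_ : NonZero L}} (ℓ : ThreePartLayout L t) where
  open ThreePartLayout ℓ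

  private
    blocks : List Block
    blocks = (lenA , colA) ∷ (a₁ + b₁ , col₁) ∷ (lenB , colB) ∷ (a₂ + b₂ , col₂) ∷ (lenC , colC) ∷ []

    in-part₀ : ∀ {x} → x < L → x / L ≡ 0
    in-part₀ x<L = /-≡ 0 refl x<L

    in-part₁ : ∀ {x r} → x ≡ (lenA + a₁) + r → r < L → x / L ≡ 1
    in-part₁ {r = r} e = /-≡ 1 (trans e (cong (_+ r) (trans part₀ (sym (*-identityˡ L)))))

    in-part₂ : ∀ {x r} → x ≡ (lenA + a₁) + (b₁ + lenB + a₂) + r → r < L → x / L ≡ 2
    in-part₂ {r = r} e =
      /-≡ 2 (trans e (cong (_+ r) (trans (cong₂ _+_ part₀ part₁) (cong (L +_) (sym (+-identityʳ L))))))

    <L : ∀ {x y} z → x < y → y + z ≡ L → x < L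
    <L z x<y y+z≡L = <-≤-trans x<y (subst (_ ≤_) y+z≡L (m≤m+n _ z))

    block-stars : StarBlocks (_/ L) blocks
    block-stars =
        monopartite-segment 0 (λ j j< → in-part₀ (<L a₁ j< part₀))
      , straddle-segment (λ j j< → in-part₀ (<-≤-trans (+-monoʳ-< lenA j<) (≤-reflexive part₀)))
                         (λ k k< → in-part₁ (sym (+-assoc lenA a₁ k))
                                            (<L (lenB + a₂) k< (trans (sym (+-assoc b₁ lenB a₂)) part₁)))
                         thin₁
      , monopartite-segment 1 (λ j j< → in-part₁ (assoc₁ lenA a₁ b₁ j) (<L a₂ (+-monoʳ-< b₁ j<) part₁))
      , straddle-segment (λ j j< → in-part₁ (assoc₂ lenA a₁ b₁ lenB j)
                                            (<-≤-trans (+-monoʳ-< (b₁ + lenB) j<) (≤-reflexive part₁)))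
                         (λ k k< → in-part₂ (assoc₃ lenA a₁ b₁ lenB a₂ k) (<L lenC k< part₂))
                         thin₂
      , monopartite-segment 2 (λ j j< → in-part₂ (assoc₄ lenA a₁ b₁ lenB a₂ b₂ j)
                                                 (<-≤-trans (+-monoʳ-< b₂ j<) (≤-reflexive part₂)))
      , _
      where
      assoc₁ : ∀ x a b j → x + (a + b + j) ≡ x + a + (b + j)
      assoc₁ = solve-∀
      assoc₂ : ∀ x a b y j → x + (a + b + (y + j)) ≡ x + a + (b + y + j)
      assoc₂ = solve-∀
      assoc₃ : ∀ x a b y a′ k → x + (a + b + (y + (a′ + k))) ≡ x + a + (b + y + a′) + k
      assoc₃ = solve-∀
      assoc₄ : ∀ x a b y a′ b′ j → x + (a + b + (y + (a′ + b′ + j))) ≡ x + a + (b + y + a′) + (b′ + j)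
      assoc₄ = solve-∀

    block-span : span blocks ≡ 3 * L
    block-span = trans (regroup lenA a₁ b₁ lenB a₂ b₂ lenC)
                       (cong₂ _+_ part₀ (cong₂ (λ y z → y + (z + 0)) part₁ part₂))
      where
      regroup : ∀ x a b y a′ b′ z →
                x + (a + b + (y + (a′ + b′ + (z + 0)))) ≡ x + a + (b + y + a′ + (b′ + z + 0))
      regroup = solve-∀

    block-colours : colours blocks ≡ t
    block-colours = trans (regroup colA col₁ colB col₂ colC) total
      where
      regroup : ∀ a b c d e → a + (b + (c + (d + (e + 0)))) ≡ a + b + c + d + e
      regroup = solve-∀

  threePartLayout⇒equitableTreeColouring : HasEqTreeColoring (K3 L) t 3
  threePartLayout⇒equitableTreeColouring =
    subst (λ t′ → HasEqTreeColoring (K3 L) t′ 3) block-colours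
          (layout⇒equitableTreeColouring L s blocks
             (balancedA ∷ balanced₁ ∷ balancedB ∷ balanced₂ ∷ balancedC ∷ []) block-stars block-span)

-- Choosing a layout for t colours

balanced-by : ∀ {s l q} x → s * q + x ≡ l → x ≤ q → Balanced s l q
balanced-by {s} {l} {q} x eq x≤q =
  balanced (subst (s * q ≤_) eq (m≤m+n (s * q) x)) (subst (_≤ s * q + q) eq (+-monoʳ-≤ (s * q) x≤q))

balanced-exact : ∀ s q → Balanced s (s * q) q
balanced-exact s q = balanced-by 0 (+-identityʳ (s * q)) z≤n

balanced-empty : ∀ s → Balanced s 0 0
balanced-empty s = balanced-by 0 (trans (+-identityʳ (s * 0)) (*-zeroʳ s)) z≤n

balanced-/ : ∀ l q .{{_ : NonZero q}} → Balanced (l / q) l q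
balanced-/ l q = balanced-by (l % q) (trans (+-comm _ (l % q)) (sym (m≡m%n+[m/n]*n l q))) (m%n≤n l q)

balanced-/-pred : ∀ l q → l % suc q + l / suc q ≤ q → Balanced (l / suc q) l q
balanced-/-pred l q fits =
  balanced-by (l % suc q + l / suc q) (trans (regroup (l / suc q) q (l % suc q)) (sym (m≡m%n+[m/n]*n l (suc q)))) fits
  where
  regroup : ∀ s q e → s * q + (e + s) ≡ e + s * suc q
  regroup = solve-∀

¬4∣4q+d : ∀ q {d} → 0 < d → d < 4 → ¬ 4 ∣ 4 * q + d
¬4∣4q+d q {suc d} _ d<4 4∣ = <⇒≱ d<4 (∣⇒≤ (∣m+n∣m⇒∣n 4∣ (m∣m*n q)))

¬4∣2q+1 : ∀ q → ¬ 4 ∣ 2 * q + 1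
¬4∣2q+1 q 4∣ = <-irrefl refl (∣⇒≤ (∣m+n∣m⇒∣n (∣-trans (divides 2 refl) 4∣) (m∣m*n q)))

-- With e = L mod (q+1) and s = L div (q+1), the inequality q < e + s says that no common class
-- size fits both q and q+1 colours on a part of length L.
exceptional-length : ∀ {L q e s} → 4 ∣ L → L ≤ 5 * q → L ≡ e + s * suc q → e ≤ q → q < e + s →
                     L ≡ 3 * q + 1 ⊎ L ≡ 3 * q + 2
exceptional-length {q = q} {e} {zero} _ _ _ e≤q q<e =
  ⊥-elim (<⇒≱ q<e (≤-trans (≤-reflexive (+-identityʳ e)) e≤q))
exceptional-length {q = q} {e} {1} 4∣L _ refl e≤q q<e+1
  with ≤-antisym e≤q (s≤s⁻¹ (subst (q <_) (+-comm e 1) q<e+1))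
... | refl = ⊥-elim (¬4∣2q+1 q (subst (4 ∣_) (length-1 q) 4∣L))
  where
  length-1 : ∀ q → q + 1 * suc q ≡ 2 * q + 1
  length-1 = solve-∀
exceptional-length {q = q} {e} {2} _ _ refl e≤q q<e+2 with m≤n⇒m<n∨m≡n e≤q
... | inj₂ refl = inj₂ (length-2 q)
  where
  length-2 : ∀ q → q + 2 * suc q ≡ 3 * q + 2
  length-2 = solve-∀
... | inj₁ e<q with ≤-antisym e<q (s≤s⁻¹ (subst (q <_) (+-comm e 2) q<e+2))
...   | refl = inj₁ (length-2 e)
  where
  length-2 : ∀ e → e + 2 * suc (suc e) ≡ 3 * suc e + 1
  length-2 = solve-∀
exceptional-length {q = q} {e} {3} 4∣L _ refl e≤q q<e+3 with m≤n⇒∃[o]m+o≡n q<e+3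
... | d , q+1+d≡e+3 = ⊥-elim (¬4∣4q+d q z<s (s≤s (s≤s d≤2)) (subst (4 ∣_) length-3 4∣L))
  where
  d≤2 : d ≤ 2
  d≤2 = +-cancelˡ-≤ (suc q) d 2 (begin
    suc q + d  ≡⟨ q+1+d≡e+3 ⟩
    e + 3      ≤⟨ +-monoˡ-≤ 3 e≤q ⟩
    q + 3      ≡⟨ +-suc q 2 ⟩
    suc q + 2  ∎)
    where open ≤-Reasoning
  length-3 : e + 3 * suc q ≡ 4 * q + suc d
  length-3 = begin
    e + 3 * suc q      ≡⟨ split e q ⟩
    (e + 3) + 3 * q    ≡⟨ cong (_+ 3 * q) (sym q+1+d≡e+3) ⟩
    (suc q + d) + 3 * q ≡⟨ merge q d ⟩
    4 * q + suc d      ∎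
    where
    open ≡-Reasoning
    split : ∀ e q → e + 3 * suc q ≡ (e + 3) + 3 * q
    split = solve-∀
    merge : ∀ q d → (suc q + d) + 3 * q ≡ 4 * q + suc d
    merge = solve-∀
exceptional-length {q = q} {e} {s@(suc (suc (suc (suc _))))} _ L≤5q refl _ q<e+s = ⊥-elim (<⇒≱ too-long L≤5q)
  where
  too-long : 5 * q < e + s * suc q
  too-long = begin-strict
    q + 4 * q        <⟨ +-monoˡ-< (4 * q) q<e+s ⟩
    e + s + 4 * q    ≤⟨ +-monoʳ-≤ (e + s) (*-monoˡ-≤ q {4} {s} (s≤s (s≤s (s≤s (s≤s z≤n))))) ⟩
    e + s + s * q    ≡⟨ regroup e s q ⟩
    e + s * suc q    ∎
    where
    open ≤-Reasoning
    regroup : ∀ e s q → e + s + s * q ≡ e + s * suc q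
    regroup = solve-∀

thin-empty : Thin 0 0
thin-empty = z≤n , inj₁ z≤n

thin-1-2 : Thin 1 2
thin-1-2 = n≤1+n 3 , inj₁ ≤-refl

thin-2-1 : Thin 2 1
thin-2-1 = n≤1+n 3 , inj₂ ≤-refl

thin-1-1 : Thin 1 1
thin-1-1 = s≤s (s≤s z≤n) , inj₁ ≤-refl

uniformLayout : ∀ {L t s qA qB qC} → Balanced s L qA → Balanced s L qB → Balanced s L qC →
                qA + qB + qC ≡ t → ThreePartLayout L t
uniformLayout {L} {s = s} {qA} {qB} {qC} bA bB bC total = record
  { s = s ; lenA = L ; a₁ = 0 ; b₁ = 0 ; lenB = L ; a₂ = 0 ; b₂ = 0 ; lenC = L
  ; colA = qA ; col₁ = 0 ; colB = qB ; col₂ = 0 ; colC = qC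
  ; part₀ = +-identityʳ L ; part₁ = +-identityʳ L ; part₂ = refl
  ; balancedA = bA ; balanced₁ = balanced-empty s ; balancedB = bB ; balanced₂ = balanced-empty s ; balancedC = bC
  ; thin₁ = thin-empty ; thin₂ = thin-empty
  ; total = trans (cong (_+ qC) (trans (+-identityʳ _) (cong (_+ qB) (+-identityʳ qA)))) total
  }

exceptionalLayout₁₁ : ∀ {L} p → L ≡ 3 * suc p + 1 → ThreePartLayout L (3 * suc p + 1)
exceptionalLayout₁₁ {L} p L≡ = record
  { s = 3 ; lenA = 3 * suc p ; a₁ = 1 ; b₁ = 2 ; lenB = 3 * p ; a₂ = 2 ; b₂ = 1 ; lenC = 3 * suc p
  ; colA = suc p ; col₁ = 1 ; colB = p ; col₂ = 1 ; colC = suc p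
  ; part₀ = sym L≡ ; part₁ = trans (middle p) (sym L≡) ; part₂ = trans (+-comm 1 _) (sym L≡)
  ; balancedA = balanced-exact 3 (suc p) ; balanced₁ = balanced-exact 3 1 ; balancedB = balanced-exact 3 p
  ; balanced₂ = balanced-exact 3 1 ; balancedC = balanced-exact 3 (suc p)
  ; thin₁ = thin-1-2 ; thin₂ = thin-2-1
  ; total = colourCount p
  }
  where
  middle : ∀ p → 2 + 3 * p + 2 ≡ 3 * suc p + 1
  middle = solve-∀
  colourCount : ∀ p → suc p + 1 + p + 1 + suc p ≡ 3 * suc p + 1
  colourCount = solve-∀

exceptionalLayout₂₁ : ∀ {L} p → L ≡ 3 * suc (suc p) + 2 → ThreePartLayout L (3 * suc (suc p) + 1)
exceptionalLayout₂₁ {L} p L≡ = record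
  { s = 3 ; lenA = 3 * q + 2 ; a₁ = 0 ; b₁ = 0 ; lenB = 3 * q + 1 ; a₂ = 1 ; b₂ = 2 ; lenC = 3 * q
  ; colA = q ; col₁ = 0 ; colB = q ; col₂ = 1 ; colC = q
  ; part₀ = trans (+-identityʳ _) (sym L≡) ; part₁ = trans (+-assoc (3 * q) 1 1) (sym L≡)
  ; part₂ = trans (+-comm 2 _) (sym L≡)
  ; balancedA = balanced-by 2 refl (s≤s (s≤s z≤n)) ; balanced₁ = balanced-empty 3
  ; balancedB = balanced-by 1 refl (s≤s z≤n) ; balanced₂ = balanced-exact 3 1 ; balancedC = balanced-exact 3 q
  ; thin₁ = thin-empty ; thin₂ = thin-1-2
  ; total = colourCount q
  }
  where
  q = suc (suc p)
  colourCount : ∀ q → q + 0 + q + 1 + q ≡ 3 * q + 1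
  colourCount = solve-∀

exceptionalLayout₁₂ : ∀ {L} p → L ≡ 3 * suc p + 1 → ThreePartLayout L (3 * suc p + 2)
exceptionalLayout₁₂ {L} p L≡ = record
  { s = 2 ; lenA = 3 * q + 1 ; a₁ = 0 ; b₁ = 0 ; lenB = 3 * q ; a₂ = 1 ; b₂ = 1 ; lenC = 3 * q
  ; colA = suc q ; col₁ = 0 ; colB = q ; col₂ = 1 ; colC = q
  ; part₀ = trans (+-identityʳ _) (sym L≡) ; part₁ = sym L≡ ; part₂ = trans (+-comm 1 _) (sym L≡)
  ; balancedA = balanced-by p (first p) (≤-trans (n≤1+n p) (n≤1+n q)) ; balanced₁ = balanced-empty 2
  ; balancedB = balanced-by q (third q) ≤-refl ; balanced₂ = balanced-exact 2 1
  ; balancedC = balanced-by q (third q) ≤-refl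
  ; thin₁ = thin-empty ; thin₂ = thin-1-1
  ; total = colourCount q
  }
  where
  q = suc p
  first : ∀ p → 2 * suc (suc p) + p ≡ 3 * suc p + 1
  first = solve-∀
  third : ∀ q → 2 * q + q ≡ 3 * q
  third = solve-∀
  colourCount : ∀ q → suc q + 0 + q + 1 + q ≡ 3 * q + 2
  colourCount = solve-∀

exceptionalLayout₂₂ : ∀ {L} q → L ≡ 3 * q + 2 → ThreePartLayout L (3 * q + 2)
exceptionalLayout₂₂ {L} q L≡ = record
  { s = 3 ; lenA = 3 * q ; a₁ = 2 ; b₁ = 1 ; lenB = 3 * q ; a₂ = 1 ; b₂ = 2 ; lenC = 3 * q
  ; colA = q ; col₁ = 1 ; colB = q ; col₂ = 1 ; colC = q
  ; part₀ = sym L≡ ; part₁ = trans (middle q) (sym L≡) ; part₂ = trans (+-comm 2 _) (sym L≡)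
  ; balancedA = balanced-exact 3 q ; balanced₁ = balanced-exact 3 1 ; balancedB = balanced-exact 3 q
  ; balanced₂ = balanced-exact 3 1 ; balancedC = balanced-exact 3 q
  ; thin₁ = thin-2-1 ; thin₂ = thin-1-2
  ; total = colourCount q
  }
  where
  middle : ∀ q → 1 + 3 * q + 1 ≡ 3 * q + 2
  middle = solve-∀
  colourCount : ∀ q → q + 1 + q + 1 + q ≡ 3 * q + 2
  colourCount = solve-∀

balanced-pred-or-exceptional : ∀ {L} q → 4 ∣ L → L ≤ 5 * q →
                               Balanced (L / suc q) L q ⊎ (L ≡ 3 * q + 1 ⊎ L ≡ 3 * q + 2)
balanced-pred-or-exceptional {L} q 4∣L L≤5q with L % suc q + L / suc q ≤? q
... | yes fits = inj₁ (balanced-/-pred L q fits)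
... | no  fits =
  inj₂ (exceptional-length 4∣L L≤5q (m≡m%n+[m/n]*n L (suc q)) (s≤s⁻¹ (m%n<n L (suc q))) (≰⇒> fits))

threePartLayout : ∀ {L} q r → r < 3 → 4 ∣ L → 0 < L → L ≤ 5 * q → ThreePartLayout L (3 * q + r)
threePartLayout zero    _ _ _ 0<L L≤0 = ⊥-elim (<⇒≱ 0<L L≤0)
threePartLayout {L} (suc q) 0 _ _ _ _ = uniformLayout b b b (colourCount q)
  where
  b = balanced-/ L (suc q)
  colourCount : ∀ q → suc q + suc q + suc q ≡ 3 * suc q + 0
  colourCount = solve-∀
threePartLayout {L} (suc q) 1 _ 4∣L _ L≤5q with balanced-pred-or-exceptional (suc q) 4∣L L≤5q
... | inj₁ b        = uniformLayout (balanced-/ L (2 + q)) b b (colourCount q)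
  where
  colourCount : ∀ q → suc (suc q) + suc q + suc q ≡ 3 * suc q + 1
  colourCount = solve-∀
... | inj₂ (inj₁ L≡) = exceptionalLayout₁₁ q L≡
... | inj₂ (inj₂ L≡) with q
...   | zero  = ⊥-elim (¬4∣4q+d 1 z<s (s≤s (s≤s z≤n)) (subst (4 ∣_) L≡ 4∣L))
...   | suc p = exceptionalLayout₂₁ p L≡
threePartLayout {L} (suc q) 2 _ 4∣L _ L≤5q with balanced-pred-or-exceptional (suc q) 4∣L L≤5q
... | inj₁ b        = uniformLayout (balanced-/ L (2 + q)) (balanced-/ L (2 + q)) b (colourCount q)
  where
  colourCount : ∀ q → suc (suc q) + suc (suc q) + suc q ≡ 3 * suc q + 2
  colourCount = solve-∀
... | inj₂ (inj₁ L≡) = exceptionalLayout₁₂ q L≡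
... | inj₂ (inj₂ L≡) = exceptionalLayout₂₂ (suc q) L≡
threePartLayout (suc _) (suc (suc (suc _))) (s≤s (s≤s (s≤s ()))) _ _ _

4k≤5q : ∀ {k m q r} → 5 * m ≤ k → r < 3 → 3 * k ∸ 3 * m ≤ 3 * q + r → 4 * k ≤ 5 * q
4k≤5q {k} {m} {q} {r} 5m≤k r<3 lower = begin
  4 * k            ≤⟨ m+n≤o⇒m≤o∸n (4 * k) 4k+5m≤5k ⟩
  5 * k ∸ 5 * m    ≡⟨ *-distribˡ-∸ 5 k m ⟨
  5 * (k ∸ m)      ≤⟨ *-monoʳ-≤ 5 k∸m≤q ⟩
  5 * q            ∎
  where
  open ≤-Reasoning
  4k+5m≤5k : 4 * k + 5 * m ≤ 5 * k
  4k+5m≤5k = ≤-trans (+-monoʳ-≤ (4 * k) 5m≤k) (≤-reflexive (+-comm (4 * k) k))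
  k∸m≤q : k ∸ m ≤ q
  k∸m≤q = s≤s⁻¹ (*-cancelˡ-< 3 (k ∸ m) (suc q) (begin-strict
    3 * (k ∸ m)      ≡⟨ *-distribˡ-∸ 3 k m ⟩
    3 * k ∸ 3 * m    ≤⟨ lower ⟩
    3 * q + r        <⟨ +-monoʳ-< (3 * q) r<3 ⟩
    3 * q + 3        ≡⟨ +-comm (3 * q) 3 ⟩
    3 + 3 * q        ≡⟨ *-suc 3 q ⟨
    3 * suc q        ∎))

proposition2 : (k m : ℕ) → 0 < k → 5 * m ≤ k →
    StrongEqVAAtMost (K3 (4 * k)) 3 (3 * k ∸ 3 * m)
proposition2 k@(suc _) m _ 5m≤k t 3k∸3m≤t =
  subst (λ t′ → HasEqTreeColoring (K3 (4 * k)) t′ 3) (sym t≡3q+r)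
    (threePartLayout⇒equitableTreeColouring
      (threePartLayout (t / 3) (t % 3) (m%n<n t 3) (m∣m*n k) z<s
        (4k≤5q {m = m} {t / 3} 5m≤k (m%n<n t 3) (subst (3 * k ∸ 3 * m ≤_) t≡3q+r 3k∸3m≤t))))
  where
  t≡3q+r : t ≡ 3 * (t / 3) + t % 3
  t≡3q+r = trans (m≡m%n+[m/n]*n t 3) (trans (+-comm (t % 3) _) (cong (_+ t % 3) (*-comm (t / 3) 3)))
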